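{- Fix an integer $b\ge2$. There is a periodic set $A\subseteq\mathbb N$, with density $d$, such that for every $u\in\{0,\dots,b-1\}^{\mathbb N}$ with $u(n)=0$ for all $n\notin A$ and $\underline\beta(u)=d\frac{b-1}{b}$, there exists $v\in\{0,\dots,b-1\}^{\mathbb N}$ with $v(n)=u(n)$ for all $n\in A$ and $\overline\beta(v)<d\frac{b-1}{b}$.
   Context: $\mathbb N=\{0,1,2,\dots\}$. A set $A\subseteq\mathbb N$ is periodic with period $p\ge1$ if $n\in A\iff n+p\in A$ for all $n$; its density is $\lim_{n\to\infty}|A\cap\{0,\dots,n-1\}|/n$. For a sequence $u\in\{0,\dots,b-1\}^{\mathbb N}$ and $\ell\ge1$, let $\mathcal E_\ell$ be the set of all functions $E:\{0,\dots,b-1\}^\ell\to\{0,\dots,b-1\}$ and $\beta_\ell(u,N)=\inf_{E\in\mathcal E_\ell}\frac1N\sum_{n<N}\min\{1,|u(n)-E(u(n+1),\dots,u(n+\ell))|\}$. The lower noise is $\underline\beta(u)=\lim_{\ell\to\infty}\liminf_{N\to\infty}\beta_\ell(u,N)$ and the upper noise is $\overline\beta(u)=\lim_{\ell\to\infty}\limsup_{N\to\infty}\beta_\ell(u,N)$. -}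

module Defs where

open import Data.Nat as ℕ using (ℕ; zero; suc; _∸_)
open import Data.Bool using (Bool; true; false; if_then_else_; not)
open import Data.Fin using (Fin; toℕ)
open import Data.Fin.Properties using (_≟_)
open import Data.Vec using (Vec; tabulate)
open import Data.Integer using (+_)
open import Data.Rational using (ℚ; 0ℚ; _/_; _≤_; _<_; _+_; _-_; _*_; ∣_∣)
open import Data.Product using (Σ; _×_; ∃)
open import Relation.Nullary using (¬_)
open import Relation.Nullary.Decidable using (⌊_⌋)

count : (ℕ → Bool) → ℕ → ℕ
count P zero = 0
count P (suc N) = count P N ℕ.+ (if P N then 1 else 0)

-- k / N as a rational (value at N = 0 is irrelevant: only limits over N are used)
ratio : ℕ → ℕ → ℚ
ratio k zero = 0ℚ
ratio k (suc n) = (+ k) / suc n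

-- Sets A ⊆ ℕ are represented by their (decidable) characteristic function.
Periodic : (ℕ → Bool) → ℕ → Set
Periodic A p = (1 ℕ.≤ p) × (∀ n → A n ≡ A (n ℕ.+ p))
  where open import Relation.Binary.PropositionalEquality using (_≡_)

HasDensity : (ℕ → Bool) → ℚ → Set
HasDensity A d = ∀ ε → 0ℚ < ε → Σ ℕ λ N₀ → ∀ N → N₀ ℕ.≤ N →
  ∣ ratio (count A N) N - d ∣ ≤ ε

window : {b : ℕ} → (ℕ → Fin b) → (ℓ n : ℕ) → Vec (Fin b) ℓ
window u ℓ n = tabulate (λ i → u (n ℕ.+ suc (toℕ i)))

-- Σ_{n<N} min{1, |u(n) - E(window)|} = number of n < N with u(n) ≠ E(window)
errors : {b ℓ : ℕ} → (ℕ → Fin b) → (Vec (Fin b) ℓ → Fin b) → ℕ → ℕ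
errors {ℓ = ℓ} u E N = count (λ n → not ⌊ u n ≟ E (window u ℓ n) ⌋) N

-- β_ℓ(u,N) = inf over E of errors/N, described by its order relation to rationals
-- (exact characterisation of the infimum of a set of rationals):
-- y ≤ β_ℓ(u,N)
BetaGe : (b : ℕ) → (ℕ → Fin b) → (ℓ N : ℕ) → ℚ → Set
BetaGe b u ℓ N y = ∀ (E : Vec (Fin b) ℓ → Fin b) → y ≤ ratio (errors u E N) N

BetaLe : (b : ℕ) → (ℕ → Fin b) → (ℓ N : ℕ) → ℚ → Set
BetaLe b u ℓ N y = ∀ δ → 0ℚ < δ →
  Σ (Vec (Fin b) ℓ → Fin b) λ E → ratio (errors u E N) N ≤ y + δ

LiminfGe : (b : ℕ) → (ℕ → Fin b) → ℕ → ℚ → Set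
LiminfGe b u ℓ x = ∀ ε → 0ℚ < ε → Σ ℕ λ N₀ → ∀ N → N₀ ℕ.≤ N → BetaGe b u ℓ N (x - ε)

LiminfLe : (b : ℕ) → (ℕ → Fin b) → ℕ → ℚ → Set
LiminfLe b u ℓ x = ∀ ε → 0ℚ < ε → ∀ N₀ → Σ ℕ λ N → (N₀ ℕ.≤ N) × BetaLe b u ℓ N (x + ε)

LimsupLe : (b : ℕ) → (ℕ → Fin b) → ℕ → ℚ → Set
LimsupLe b u ℓ x = ∀ ε → 0ℚ < ε → Σ ℕ λ N₀ → ∀ N → N₀ ℕ.≤ N → BetaLe b u ℓ N (x + ε)

LowerNoiseEq : (b : ℕ) → (ℕ → Fin b) → ℚ → Set
LowerNoiseEq b u c = ∀ ε → 0ℚ < ε → Σ ℕ λ ℓ₀ → ∀ ℓ → ℓ₀ ℕ.≤ ℓ →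
  LiminfGe b u ℓ (c - ε) × LiminfLe b u ℓ (c + ε)

-- upper noise of v is < c :  lim_ℓ limsup_N β_ℓ(v,N) < c
-- (the limit exists since limsup_N β_ℓ is nonincreasing in ℓ; a convergent
--  sequence has limit < c iff it is eventually ≤ c - ε for some ε > 0)
UpperNoiseLt : (b : ℕ) → (ℕ → Fin b) → ℚ → Set
UpperNoiseLt b v c = Σ ℚ λ ε → (0ℚ < ε) × (Σ ℕ λ ℓ₀ → ∀ ℓ → ℓ₀ ℕ.≤ ℓ → LimsupLe b v ℓ (c - ε))

critical : ℕ → ℚ → ℚ
critical b d = d * ratio (b ∸ 1) b

-- Cut ℕ into blocks of length L = 10 + b³ and let A consist of the cells 5, 6, 7 of every
-- block, so that A is periodic of density d = 3/L. Given u, the sequence v agrees with u on A,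
-- has the sync word 1111 in cells 0–3 of each block, and encodes the block's three data symbols
-- in unary: a single 1 among the b³ cells 9, …, 8 + b³; every other cell is 0. Reading a window
-- of length at least L + 3, a predictor locates the next sync word, which gives the phase of the
-- current cell within its block, and decodes the data from the code region. It errs only at
-- the one marker cell per block, so the upper noise of v is at most 1/L, which is below
-- d (b - 1) / b because 3 (b - 1) / b > 1 for b ≥ 2.

module Submission where

open import Defs
open import Data.Bool using (Bool; true; false; if_then_else_; not; _∧_)
open import Data.Bool.Properties using (∧-zeroʳ)
open import Data.Empty using (⊥-elim)
open import Data.Fin as Fin using (Fin; zero; suc; toℕ; combine; remQuot)
open import Data.Fin.Properties using (toℕ<n; toℕ-fromℕ<; toℕ-injective; remQuot-combine)
open import Data.Integer as ℤ using (+_)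
import Data.Integer.Properties as ℤP
open import Data.Nat
open import Data.Nat.DivMod
open import Data.Nat.Divisibility using (divides-refl)
open import Data.Nat.Properties
open import Data.Nat.Tactic.RingSolver using (solve-∀)
open import Data.Product using (Σ; _×_; _,_; proj₁; proj₂; map₂)
open import Data.Sum using (_⊎_; inj₁; inj₂)
open import Data.Rational as ℚ using (ℚ; 0ℚ; toℚᵘ; mkℚ)
import Data.Rational.Properties as ℚP
open import Data.Rational.Solver using (module +-*-Solver)
open import Data.Rational.Unnormalised as ℚᵘ using (mkℚᵘ; *≤*; *<*)
import Data.Rational.Unnormalised.Properties as ℚᵘP
open import Data.Vec using (Vec; []; _∷_; tabulate)
open import Function using (_∘_)
open import Relation.Binary.PropositionalEquality
open import Relation.Nullary using (does; yes; no)
open import Relation.Nullary.Decidable using (⌊_⌋; dec-true; dec-false; decidable-stable)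
open import Relation.Nullary.Negation using (contradiction)

-- Counting block by block

count-+ : ∀ P m n → count P (m + n) ≡ count P m + count (λ i → P (m + i)) n
count-+ P m zero    rewrite +-identityʳ m = sym (+-identityʳ _)
count-+ P m (suc n) rewrite +-suc m n | count-+ P m n = +-assoc (count P m) _ _

count-cong : ∀ {P Q} N → (∀ n → n < N → P n ≡ Q n) → count P N ≡ count Q N
count-cong zero    eq = refl
count-cong (suc N) eq =
  cong₂ (λ c x → c + (if x then 1 else 0)) (count-cong N (λ n n<N → eq n (m<n⇒m<1+n n<N))) (eq N ≤-refl)

count-monoʳ : ∀ P {m n} → m ≤ n → count P m ≤ count P n
count-monoʳ P {m} m≤n with m≤n⇒∃[o]m+o≡n m≤n
... | o , refl rewrite count-+ P m o = m≤m+n _ _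

count-false : ∀ {P} N → (∀ n → n < N → P n ≡ false) → count P N ≡ 0
count-false zero    eq = refl
count-false (suc N) eq rewrite eq N ≤-refl | count-false N (λ n n<N → eq n (m<n⇒m<1+n n<N)) = refl

count-≤1 : ∀ {P} m N → (∀ n → n < N → P n ≡ true → n ≡ m) → count P N ≤ 1
count-≤1         m zero    only = z≤n
count-≤1 {P = P} m (suc N) only with P N in PN
... | false = ≤-trans (≤-reflexive (+-identityʳ _)) (count-≤1 m N (λ n n<N → only n (m<n⇒m<1+n n<N)))
... | true  = ≤-reflexive (cong (_+ 1) (count-false N none-before))
  where
  none-before : ∀ n → n < N → P n ≡ false
  none-before n n<N with P n in Pn
  ... | false = refl
  ... | true  = ⊥-elim (<⇒≢ n<N (trans (only n (m<n⇒m<1+n n<N) Pn) (sym (only N ≤-refl PN))))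

[q*n+r]/n≡q : ∀ q {n r} .{{_ : NonZero n}} → r < n → (q * n + r) / n ≡ q
[q*n+r]/n≡q q {n} {r} r<n = begin
  (q * n + r) / n    ≡⟨ +-distrib-/-∣ˡ r (divides-refl q) ⟩
  q * n / n + r / n  ≡⟨ cong₂ _+_ (m*n/n≡m q n) (m<n⇒m/n≡0 r<n) ⟩
  q + 0              ≡⟨ +-identityʳ q ⟩
  q                  ∎
  where open ≡-Reasoning

[q*n+r]%n≡r : ∀ q {n r} .{{_ : NonZero n}} → r < n → (q * n + r) % n ≡ r
[q*n+r]%n≡r q r<n = trans (%-remove-+ˡ _ (divides-refl q)) (m<n⇒m%n≡m r<n)

m<[1+m/n]*n : ∀ m n .{{_ : NonZero n}} → m < suc (m / n) * n
m<[1+m/n]*n m n = begin-strict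
  m                  ≡⟨ m≡m%n+[m/n]*n m n ⟩
  m % n + m / n * n  <⟨ +-monoˡ-< (m / n * n) (m%n<n m n) ⟩
  suc (m / n) * n    ∎
  where open ≤-Reasoning

module _ (P : ℕ → Bool) (L : ℕ) where

  blockCount : ℕ → ℕ
  blockCount q = count (λ r → P (q * L + r)) L

  count-suc-* : ∀ k → count P (suc k * L) ≡ count P (k * L) + blockCount k
  count-suc-* k = trans (cong (count P) (+-comm L (k * L))) (count-+ P (k * L) L)

  count-*-≤ : ∀ {c} → (∀ q → blockCount q ≤ c) → ∀ k → count P (k * L) ≤ k * c
  count-*-≤     bound zero    = z≤n
  count-*-≤ {c} bound (suc k) = begin
    count P (suc k * L)             ≡⟨ count-suc-* k ⟩
    count P (k * L) + blockCount k  ≤⟨ +-mono-≤ (count-*-≤ bound k) (bound k) ⟩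
    k * c + c                       ≡⟨ +-comm (k * c) c ⟩
    suc k * c                       ∎
    where open ≤-Reasoning

  count-*-≥ : ∀ {c} → (∀ q → c ≤ blockCount q) → ∀ k → k * c ≤ count P (k * L)
  count-*-≥     bound zero    = z≤n
  count-*-≥ {c} bound (suc k) = begin
    suc k * c                       ≡⟨ +-comm c (k * c) ⟩
    k * c + c                       ≤⟨ +-mono-≤ (count-*-≥ bound k) (bound k) ⟩
    count P (k * L) + blockCount k  ≡⟨ count-suc-* k ⟨
    count P (suc k * L)             ∎
    where open ≤-Reasoning

  module _ .{{_ : NonZero L}} {c : ℕ} where

    count-≤-blocks : (∀ q → blockCount q ≤ c) → ∀ N → count P N * L ≤ c * N + c * L
    count-≤-blocks bound N = begin
      count P N * L              ≤⟨ *-monoˡ-≤ L (count-monoʳ P (<⇒≤ (m<[1+m/n]*n N L))) ⟩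
      count P (suc q * L) * L    ≤⟨ *-monoˡ-≤ L (count-*-≤ bound (suc q)) ⟩
      suc q * c * L              ≡⟨ regroup q c L ⟩
      c * (q * L) + c * L        ≤⟨ +-monoˡ-≤ (c * L) (*-monoʳ-≤ c (m/n*n≤m N L)) ⟩
      c * N + c * L              ∎
      where
      open ≤-Reasoning
      q = N / L
      regroup : ∀ q c L → suc q * c * L ≡ c * (q * L) + c * L
      regroup = solve-∀

    count-≥-blocks : (∀ q → c ≤ blockCount q) → ∀ N → c * N ≤ count P N * L + c * L
    count-≥-blocks bound N = begin
      c * N                        ≤⟨ *-monoʳ-≤ c (<⇒≤ (m<[1+m/n]*n N L)) ⟩
      c * (suc q * L)              ≡⟨ regroup q c L ⟩
      q * c * L + c * L            ≤⟨ +-monoˡ-≤ (c * L) (*-monoˡ-≤ L (count-*-≥ bound q)) ⟩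
      count P (q * L) * L + c * L  ≤⟨ +-monoˡ-≤ (c * L) (*-monoˡ-≤ L (count-monoʳ P (m/n*n≤m N L))) ⟩
      count P N * L + c * L        ∎
      where
      open ≤-Reasoning
      q = N / L
      regroup : ∀ q c L → c * (suc q * L) ≡ q * c * L + c * L
      regroup = solve-∀

-- Comparing ratios by cross-multiplication

toℚᵘ-ratio : ∀ a n → toℚᵘ (ratio a (suc n)) ℚᵘ.≃ mkℚᵘ (+ a) n
toℚᵘ-ratio a n = ℚP.toℚᵘ-fromℚᵘ (mkℚᵘ (+ a) n)

ratio-≤-+ : ∀ a b c {n m p} → a * (suc m * suc p) ≤ (b * suc p + c * suc m) * suc n →
  ratio a (suc n) ℚ.≤ ratio b (suc m) ℚ.+ ratio c (suc p)
ratio-≤-+ a b c {n} {m} {p} h = ℚP.toℚᵘ-cancel-≤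
  (ℚᵘP.≤-respˡ-≃ (ℚᵘP.≃-sym (toℚᵘ-ratio a n))
  (ℚᵘP.≤-respʳ-≃ (ℚᵘP.≃-sym (ℚᵘP.≃-trans (ℚP.toℚᵘ-homo-+ (ratio b (suc m)) (ratio c (suc p)))
                                           (ℚᵘP.+-cong (toℚᵘ-ratio b m) (toℚᵘ-ratio c p))))
  (*≤* (subst₂ ℤ._≤_ (ℤP.pos-* a (suc m * suc p)) numerator (ℤ.+≤+ h)))))
  where
  numerator : + ((b * suc p + c * suc m) * suc n) ≡ (+ b ℤ.* + suc p ℤ.+ + c ℤ.* + suc m) ℤ.* + suc n
  numerator = trans (ℤP.pos-* (b * suc p + c * suc m) (suc n))
    (cong (ℤ._* + suc n) (trans (ℤP.pos-+ (b * suc p) (c * suc m))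
                                (cong₂ ℤ._+_ (ℤP.pos-* b (suc p)) (ℤP.pos-* c (suc m)))))

ratio-<-* : ∀ a b c {n m p} → a * (suc m * suc p) < b * c * suc n →
  ratio a (suc n) ℚ.< ratio b (suc m) ℚ.* ratio c (suc p)
ratio-<-* a b c {n} {m} {p} h = ℚP.toℚᵘ-cancel-<
  (ℚᵘP.<-respˡ-≃ (ℚᵘP.≃-sym (toℚᵘ-ratio a n))
  (ℚᵘP.<-respʳ-≃ (ℚᵘP.≃-sym (ℚᵘP.≃-trans (ℚP.toℚᵘ-homo-* (ratio b (suc m)) (ratio c (suc p)))
                                           (ℚᵘP.*-cong (toℚᵘ-ratio b m) (toℚᵘ-ratio c p))))
  (*<* (subst₂ ℤ._<_ (ℤP.pos-* a (suc m * suc p)) numerator (ℤ.+<+ h)))))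
  where
  numerator : + (b * c * suc n) ≡ + b ℤ.* + c ℤ.* + suc n
  numerator = trans (ℤP.pos-* (b * c) (suc n)) (cong (ℤ._* + suc n) (ℤP.pos-* b c))

ratio-≤-ratio+ : ∀ a k c {n m} → a * suc m ≤ k * suc n + c * suc m →
  ratio a (suc n) ℚ.≤ ratio k (suc m) ℚ.+ ratio c (suc n)
ratio-≤-ratio+ a k c {n} {m} h = ratio-≤-+ a k c (begin
  a * (suc m * suc n)              ≡⟨ *-assoc a (suc m) (suc n) ⟨
  a * suc m * suc n                ≤⟨ *-monoˡ-≤ (suc n) h ⟩
  (k * suc n + c * suc m) * suc n  ∎)
  where open ≤-Reasoning

ratio-≤-+ratio : ∀ k a c {n m} → k * suc n ≤ a * suc m + c * suc m →
  ratio k (suc m) ℚ.≤ ratio a (suc n) ℚ.+ ratio c (suc n)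
ratio-≤-+ratio k a c {n} {m} h = ratio-≤-+ k a c (begin
  k * (suc n * suc n)              ≡⟨ *-assoc k (suc n) (suc n) ⟨
  k * suc n * suc n                ≤⟨ *-monoˡ-≤ (suc n) h ⟩
  (a * suc m + c * suc m) * suc n  ≡⟨ regroup a c (suc m) (suc n) ⟩
  (a * suc n + c * suc n) * suc m  ∎)
  where
  open ≤-Reasoning
  regroup : ∀ a c M N → (a * M + c * M) * N ≡ (a * N + c * N) * M
  regroup = solve-∀

ratio-eventually-≤ : ∀ c ε → 0ℚ ℚ.< ε → Σ ℕ λ N₀ → ∀ N → N₀ ≤ N → ratio c N ℚ.≤ ε
ratio-eventually-≤ c (mkℚ (+ zero)    d _) (ℚ.*<* (ℤ.+<+ ()))
ratio-eventually-≤ c (mkℚ ℤ.-[1+ _ ]  d _) (ℚ.*<* ())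
ratio-eventually-≤ c ε@(mkℚ (+ suc p) d _) ε>0 = c * suc d , small
  where
  small : ∀ N → c * suc d ≤ N → ratio c N ℚ.≤ ε
  small zero    _ = ℚP.<⇒≤ ε>0
  small (suc n) N₀≤N = ℚP.toℚᵘ-cancel-≤ (ℚᵘP.≤-respˡ-≃ (ℚᵘP.≃-sym (toℚᵘ-ratio c n))
    (*≤* (subst₂ ℤ._≤_ (ℤP.pos-* c (suc d)) (ℤP.pos-* (suc p) (suc n))
      (ℤ.+≤+ (≤-trans N₀≤N (m≤m+n (suc n) (p * suc n)))))))

[p+q]-p≡q : ∀ p q → p ℚ.+ q ℚ.- p ≡ q
[p+q]-p≡q = solve 2 (λ p q → p :+ q :- p := q) refl
  where open +-*-Solver

p-[p-q]≡q : ∀ p q → p ℚ.- (p ℚ.- q) ≡ q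
p-[p-q]≡q = solve 2 (λ p q → p :- (p :- q) := q) refl
  where open +-*-Solver

-[p-q]≡q-p : ∀ p q → ℚ.- (p ℚ.- q) ≡ q ℚ.- p
-[p-q]≡q-p = solve 2 (λ p q → :- (p :- q) := q :- p) refl
  where open +-*-Solver

∣p-q∣≤r : ∀ {p q r} → p ℚ.≤ q ℚ.+ r → q ℚ.≤ p ℚ.+ r → ℚ.∣ p ℚ.- q ∣ ℚ.≤ r
∣p-q∣≤r {p} {q} {r} p≤q+r q≤p+r with ℚP.∣p∣≡p∨∣p∣≡-p (p ℚ.- q)
... | inj₁ ∣p-q∣≡p-q = begin
  ℚ.∣ p ℚ.- q ∣        ≡⟨ ∣p-q∣≡p-q ⟩
  p ℚ.- q              ≤⟨ ℚP.+-monoˡ-≤ (ℚ.- q) p≤q+r ⟩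
  q ℚ.+ r ℚ.- q        ≡⟨ [p+q]-p≡q q r ⟩
  r                    ∎
  where open ℚP.≤-Reasoning
... | inj₂ ∣p-q∣≡q-p = begin
  ℚ.∣ p ℚ.- q ∣        ≡⟨ ∣p-q∣≡q-p ⟩
  ℚ.- (p ℚ.- q)        ≡⟨ -[p-q]≡q-p p q ⟩
  q ℚ.- p              ≤⟨ ℚP.+-monoˡ-≤ (ℚ.- p) q≤p+r ⟩
  p ℚ.+ r ℚ.- p        ≡⟨ [p+q]-p≡q p r ⟩
  r                    ∎
  where open ℚP.≤-Reasoning


-- Density and upper noise from block counts

periodic-+* : ∀ {A : ℕ → Bool} {p} → (∀ n → A n ≡ A (n + p)) → ∀ q r → A (q * p + r) ≡ A r
periodic-+*             period zero    r = refl
periodic-+* {A = A} {p} period (suc q) r = begin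
  A (suc q * p + r)  ≡⟨ cong A (regroup q p r) ⟩
  A (q * p + r + p)  ≡⟨ period (q * p + r) ⟨
  A (q * p + r)      ≡⟨ periodic-+* period q r ⟩
  A r                ∎
  where
  open ≡-Reasoning
  regroup : ∀ q p r → suc q * p + r ≡ q * p + r + p
  regroup = solve-∀

periodic⇒hasDensity : ∀ A p → Periodic A p → HasDensity A (ratio (count A p) p)
periodic⇒hasDensity A (suc p) (_ , period) ε ε>0 = suc N₀ , close
  where
  k : ℕ
  k = count A (suc p)
  eventually-small = ratio-eventually-≤ k ε ε>0
  N₀ = proj₁ eventually-small
  blocks : ∀ q → blockCount A (suc p) q ≡ k
  blocks q = count-cong (suc p) (λ r _ → periodic-+* period q r)
  close : ∀ N → suc N₀ ≤ N → ℚ.∣ ratio (count A N) N ℚ.- ratio k (suc p) ∣ ℚ.≤ ε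
  close (suc n) (s≤s N₀≤n) = ℚP.≤-trans
    (∣p-q∣≤r (ratio-≤-ratio+ a k k (count-≤-blocks A (suc p) (≤-reflexive ∘ blocks) (suc n)))
             (ratio-≤-+ratio k a k (count-≥-blocks A (suc p) (≤-reflexive ∘ sym ∘ blocks) (suc n))))
    (proj₂ eventually-small (suc n) (m≤n⇒m≤1+n N₀≤n))
    where a = count A (suc n)

upperNoiseLt-fromErrorBound : ∀ {b} (v : ℕ → Fin b) {c} k L ℓ₀ → ratio k (suc L) ℚ.< c →
  (∀ ℓ → ℓ₀ ≤ ℓ → Σ (Vec (Fin b) ℓ → Fin b) λ E →
                     ∀ N → errors v E N * suc L ≤ k * N + k * suc L) →
  UpperNoiseLt b v c
upperNoiseLt-fromErrorBound {b} v {c} k L ℓ₀ x<c predictors =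
  c ℚ.- x , ℚP.<-respˡ-≡ (ℚP.+-inverseʳ x) (ℚP.+-monoˡ-< (ℚ.- x) x<c) , ℓ₀ , limsup
  where
  x = ratio k (suc L)
  limsup : ∀ ℓ → ℓ₀ ≤ ℓ → LimsupLe b v ℓ (c ℚ.- (c ℚ.- x))
  limsup ℓ ℓ₀≤ℓ ε ε>0 = suc N₀ , beta
    where
    E = proj₁ (predictors ℓ ℓ₀≤ℓ)
    eventually-small = ratio-eventually-≤ k ε ε>0
    N₀ = proj₁ eventually-small
    beta : ∀ N → suc N₀ ≤ N → BetaLe b v ℓ N (c ℚ.- (c ℚ.- x) ℚ.+ ε)
    beta (suc n) (s≤s N₀≤n) δ δ>0 = E , (begin
      ratio e (suc n)                ≤⟨ ratio-≤-ratio+ e k k (proj₂ (predictors ℓ ℓ₀≤ℓ) (suc n)) ⟩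
      x ℚ.+ ratio k (suc n)          ≤⟨ ℚP.+-monoʳ-≤ x (proj₂ eventually-small (suc n) (m≤n⇒m≤1+n N₀≤n)) ⟩
      x ℚ.+ ε                        ≡⟨ cong (ℚ._+ ε) (p-[p-q]≡q c x) ⟨
      y                              ≡⟨ ℚP.+-identityʳ y ⟨
      y ℚ.+ 0ℚ                       ≤⟨ ℚP.+-monoʳ-≤ y (ℚP.<⇒≤ δ>0) ⟩
      y ℚ.+ δ                        ∎)
      where
      open ℚP.≤-Reasoning
      e = errors v E (suc n)
      y = c ℚ.- (c ℚ.- x) ℚ.+ ε

-- The block code

mismatch : ∀ {n} → Fin n → Fin n → Bool
mismatch x y = not ⌊ x Fin.≟ y ⌋

mismatch-≡ : ∀ {n} {x y : Fin n} → x ≡ y → mismatch x y ≡ false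
mismatch-≡ {x = x} refl with x Fin.≟ x
... | yes _   = refl
... | no  x≢x = ⊥-elim (x≢x refl)

firstTrue : (ℕ → Bool) → ℕ → ℕ
firstTrue P zero    = zero
firstTrue P (suc n) = if P 0 then 0 else suc (firstTrue (P ∘ suc) n)

firstTrue-≡ : ∀ P {n i} → i < n → P i ≡ true → (∀ j → j < i → P j ≡ false) → firstTrue P n ≡ i
firstTrue-≡ P {suc n} {zero}  _   Pi _      rewrite Pi = refl
firstTrue-≡ P {suc n} {suc i} i<n Pi before rewrite before 0 z<s =
  cong suc (firstTrue-≡ (P ∘ suc) (s<s⁻¹ i<n) Pi (λ j j<i → before (suc j) (s<s j<i)))

module Construction (b′ : ℕ) where

  b : ℕ
  b = 2 + b′

  K : ℕ
  K = b * (b * b)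

  L : ℕ
  L = 10 + K

  one : Fin b
  one = suc zero

  isOne : Fin b → Bool
  isOne (suc zero) = true
  isOne _          = false

  isOne-if : ∀ x → isOne (if x then one else zero) ≡ x
  isOne-if true  = refl
  isOne-if false = refl

  fourOnes : (ℕ → Fin b) → Bool
  fourOnes f = isOne (f 0) ∧ isOne (f 1) ∧ isOne (f 2) ∧ isOne (f 3)

  fourOnes-cong : ∀ {f g} → (∀ k → k < 4 → f k ≡ g k) → fourOnes f ≡ fourOnes g
  fourOnes-cong f≗g
    rewrite f≗g 0 (<ᵇ⇒< 0 4 _) | f≗g 1 (<ᵇ⇒< 1 4 _) | f≗g 2 (<ᵇ⇒< 2 4 _) | f≗g 3 (<ᵇ⇒< 3 4 _) = refl

  fourOnes-true : ∀ {f} → (∀ k → k < 4 → f k ≡ one) → fourOnes f ≡ true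
  fourOnes-true f≗one
    rewrite f≗one 0 (<ᵇ⇒< 0 4 _) | f≗one 1 (<ᵇ⇒< 1 4 _) | f≗one 2 (<ᵇ⇒< 2 4 _) | f≗one 3 (<ᵇ⇒< 3 4 _) = refl

  fourOnes-false : ∀ f k → k < 4 → f k ≡ zero → fourOnes f ≡ false
  fourOnes-false f 0 _ fk≡0 rewrite fk≡0 = refl
  fourOnes-false f 1 _ fk≡0 rewrite fk≡0 = ∧-zeroʳ (isOne (f 0))
  fourOnes-false f 2 _ fk≡0 rewrite fk≡0 | ∧-zeroʳ (isOne (f 1)) = ∧-zeroʳ (isOne (f 0))
  fourOnes-false f 3 _ fk≡0
    rewrite fk≡0 | ∧-zeroʳ (isOne (f 2)) | ∧-zeroʳ (isOne (f 1)) = ∧-zeroʳ (isOne (f 0))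
  fourOnes-false f (suc (suc (suc (suc _)))) (s≤s (s≤s (s≤s (s≤s ())))) _

  syncAt : (ℕ → Fin b) → ℕ → Bool
  syncAt s i = fourOnes (λ k → s (i + k))

  isData : ℕ → Bool
  isData 5 = true
  isData 6 = true
  isData 7 = true
  isData _ = false

  isData-cases : ∀ r → isData r ≡ true → r ≡ 5 ⊎ r ≡ 6 ⊎ r ≡ 7
  isData-cases 5 _ = inj₁ refl
  isData-cases 6 _ = inj₂ (inj₁ refl)
  isData-cases 7 _ = inj₂ (inj₂ refl)
  isData-cases 0 ()
  isData-cases 1 ()
  isData-cases 2 ()
  isData-cases 3 ()
  isData-cases 4 ()
  isData-cases (suc (suc (suc (suc (suc (suc (suc (suc _)))))))) ()

  isData⇒≤8 : ∀ r → isData r ≡ true → r ≤ 8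
  isData⇒≤8 r dr with isData-cases r dr
  ... | inj₁ refl        = ≤ᵇ⇒≤ 5 8 _
  ... | inj₂ (inj₁ refl) = ≤ᵇ⇒≤ 6 8 _
  ... | inj₂ (inj₂ refl) = ≤ᵇ⇒≤ 7 8 _

  count-isData : ∀ m → count isData (8 + m) ≡ 3
  count-isData zero    = refl
  count-isData (suc m) = trans (+-identityʳ _) (count-isData m)

  layout : (ℕ → Fin b) → ℕ → Fin b
  layout d r = if isData r then d r else if r <ᵇ 4 then one else zero

  layout-cong : ∀ {d d′} r → (isData r ≡ true → d r ≡ d′ r) → layout d r ≡ layout d′ r
  layout-cong r d≗d′ with isData r in dr
  ... | true  = d≗d′ refl
  ... | false = refl

  encode : Fin b → Fin b → Fin b → Fin K
  encode x y z = combine x (combine y z)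

  decode : Fin K → Fin b × Fin b × Fin b
  decode c = map₂ (remQuot {b} b) (remQuot {b} (b * b) c)

  decode-encode : ∀ x y z → decode (encode x y z) ≡ (x , y , z)
  decode-encode x y z = trans (cong (map₂ (remQuot {b} b)) (remQuot-combine x (combine y z)))
                              (cong (x ,_) (remQuot-combine y z))

  digit : Fin K → ℕ → Fin b
  digit c 5 = proj₁ (decode c)
  digit c 6 = proj₁ (proj₂ (decode c))
  digit c 7 = proj₂ (proj₂ (decode c))
  digit c _ = zero

  readCode : (ℕ → Fin b) → Fin K
  readCode f = firstTrue (isOne ∘ f) K mod K

  readCode-≡ : ∀ f c → (∀ t → t < K → isOne (f t) ≡ does (t ≟ toℕ c)) → readCode f ≡ c
  readCode-≡ f c f≗marker = toℕ-injective (begin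
    toℕ (firstTrue (isOne ∘ f) K mod K)  ≡⟨ toℕ-fromℕ< _ ⟩
    firstTrue (isOne ∘ f) K % K          ≡⟨ cong (_% K) found ⟩
    toℕ c % K                            ≡⟨ m<n⇒m%n≡m (toℕ<n c) ⟩
    toℕ c                                ∎)
    where
    open ≡-Reasoning
    found : firstTrue (isOne ∘ f) K ≡ toℕ c
    found = firstTrue-≡ (isOne ∘ f) (toℕ<n c)
      (trans (f≗marker _ (toℕ<n c)) (dec-true (toℕ c ≟ toℕ c) refl))
      (λ j j<c → trans (f≗marker j (<-trans j<c (toℕ<n c))) (dec-false (j ≟ toℕ c) (<⇒≢ j<c)))

  at : ∀ {ℓ} → Vec (Fin b) ℓ → ℕ → Fin b
  at []      _       = zero
  at (x ∷ _) zero    = x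
  at (_ ∷ w) (suc j) = at w j

  at-tabulate : ∀ {ℓ} (g : ℕ → Fin b) j → j < ℓ → at (tabulate {n = ℓ} (g ∘ toℕ)) j ≡ g j
  at-tabulate {suc ℓ} g zero    _   = refl
  at-tabulate {suc ℓ} g (suc j) j<ℓ = at-tabulate (g ∘ suc) j (s<s⁻¹ j<ℓ)

  at-window : ∀ s ℓ n j → j < ℓ → at (window s ℓ n) j ≡ s (n + suc j)
  at-window s ℓ n = at-tabulate (λ j → s (n + suc j))

  -- A cell of phase r sees the next sync word L ∸ suc r cells into its window, and the code
  -- region 8 ∸ r cells in.
  phase : (ℕ → Fin b) → ℕ
  phase s = L ∸ suc (firstTrue (syncAt s) L)

  decodedData : (ℕ → Fin b) → ℕ → Fin b
  decodedData s r = digit (readCode (λ t → s (8 ∸ r + t))) r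

  predictor : ∀ {ℓ} → Vec (Fin b) ℓ → Fin b
  predictor w = layout (decodedData (at w)) (phase (at w))

  A : ℕ → Bool
  A n = isData (n % L)

  A-periodic : Periodic A L
  A-periodic = z<s , λ n → cong isData (sym ([m+n]%n≡m%n n L))

  A-density : HasDensity A (ratio 3 L)
  A-density = subst (λ k → HasDensity A (ratio k L)) count-A (periodic⇒hasDensity A L A-periodic)
    where
    count-A : count A L ≡ 3
    count-A = trans (count-cong L (λ r r<L → cong isData (m<n⇒m%n≡m r<L))) (count-isData (2 + K))

  critical-gap : ratio 1 L ℚ.< critical b (ratio 3 L)
  critical-gap = ratio-<-* 1 3 (suc b′) {9 + K} {9 + K} {suc b′} (begin-strict
    1 * (L * b)        ≡⟨ regroup L b ⟩
    b * L              <⟨ *-monoˡ-< L b<3[b-1] ⟩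
    3 * suc b′ * L     ∎)
    where
    open ≤-Reasoning
    regroup : ∀ L b → 1 * (L * b) ≡ b * L
    regroup = solve-∀
    b<3[b-1] : b < 3 * suc b′
    b<3[b-1] = begin-strict
      b                      <⟨ m<m+n b z<s ⟩
      b + suc (2 * b′)       ≡⟨ expand b′ ⟩
      3 * suc b′             ∎
      where
      expand : ∀ b′ → 2 + b′ + suc (2 * b′) ≡ 3 * suc b′
      expand = solve-∀

  module Encoding (u : ℕ → Fin b) where

    code : ℕ → Fin K
    code q = encode (u (q * L + 5)) (u (q * L + 6)) (u (q * L + 7))

    isMarker : ℕ → ℕ → Bool
    isMarker q r = does (r ≟ 9 + toℕ (code q))

    cell : ℕ → ℕ → Fin b
    cell q r = if isMarker q r then one else layout (λ r → u (q * L + r)) r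

    cell-data : ∀ q r → isData r ≡ true → cell q r ≡ u (q * L + r)
    cell-data q r dr with isData-cases r dr
    ... | inj₁ refl        = refl
    ... | inj₂ (inj₁ refl) = refl
    ... | inj₂ (inj₂ refl) = refl

    opaque
      v : ℕ → Fin b
      v n = cell (n / L) (n % L)

      v-block : ∀ q {r} → r < L → v (q * L + r) ≡ cell q r
      v-block q r<L rewrite [q*n+r]/n≡q q r<L | [q*n+r]%n≡r q r<L = refl

      v-agrees : ∀ n → A n ≡ true → v n ≡ u n
      v-agrees n An = trans (cell-data (n / L) (n % L) An)
                            (cong u (trans (+-comm (n / L * L) (n % L)) (sym (m≡m%n+[m/n]*n n L))))


    digit-code : ∀ q r → isData r ≡ true → digit (code q) r ≡ u (q * L + r)
    digit-code q r dr with isData-cases r dr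
    ... | inj₁ refl        = cong proj₁ (decode-encode (u (q * L + 5)) (u (q * L + 6)) (u (q * L + 7)))
    ... | inj₂ (inj₁ refl) = cong (proj₁ ∘ proj₂) (decode-encode (u (q * L + 5)) (u (q * L + 6)) (u (q * L + 7)))
    ... | inj₂ (inj₂ refl) = cong (proj₂ ∘ proj₂) (decode-encode (u (q * L + 5)) (u (q * L + 6)) (u (q * L + 7)))

    sync-start : ∀ q → syncAt v (q * L) ≡ true
    sync-start q = fourOnes-true λ k k<4 → trans (v-block q (<-trans k<4 (<ᵇ⇒< 4 L _))) (sync-cell k k<4)
      where
      sync-cell : ∀ k → k < 4 → cell q k ≡ one
      sync-cell 0 _ = refl
      sync-cell 1 _ = refl
      sync-cell 2 _ = refl
      sync-cell 3 _ = refl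
      sync-cell (suc (suc (suc (suc _)))) (s≤s (s≤s (s≤s (s≤s ()))))

    unmarked-region : ∀ q t → t ≢ toℕ (code q) → cell q (9 + t) ≡ zero
    unmarked-region q t t≢c rewrite dec-false (t ≟ toℕ (code q)) t≢c = refl

    sync-blocked : ∀ q p k {m} → p + k ≡ m → k < 4 → m < L → cell q m ≡ zero → syncAt v (q * L + p) ≡ false
    sync-blocked q p k refl k<4 m<L blank =
      fourOnes-false (λ k → v (q * L + p + k)) k k<4 (trans (cong v (+-assoc (q * L) p k)) (trans (v-block q m<L) blank))

    -- The data cells are fenced in by the zeros at 4 and 8, and the marker is followed by a
    -- zero, so four consecutive ones start only at phase 0.
    sync-false : ∀ q p → 0 < p → p < L → syncAt v (q * L + p) ≡ false
    sync-false q 1 _ _ = sync-blocked q 1 3 refl (<ᵇ⇒< 3 4 _) (<ᵇ⇒< 4 L _) refl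
    sync-false q 2 _ _ = sync-blocked q 2 2 refl (<ᵇ⇒< 2 4 _) (<ᵇ⇒< 4 L _) refl
    sync-false q 3 _ _ = sync-blocked q 3 1 refl (<ᵇ⇒< 1 4 _) (<ᵇ⇒< 4 L _) refl
    sync-false q 4 _ _ = sync-blocked q 4 0 refl (<ᵇ⇒< 0 4 _) (<ᵇ⇒< 4 L _) refl
    sync-false q 5 _ _ = sync-blocked q 5 3 refl (<ᵇ⇒< 3 4 _) (<ᵇ⇒< 8 L _) refl
    sync-false q 6 _ _ = sync-blocked q 6 2 refl (<ᵇ⇒< 2 4 _) (<ᵇ⇒< 8 L _) refl
    sync-false q 7 _ _ = sync-blocked q 7 1 refl (<ᵇ⇒< 1 4 _) (<ᵇ⇒< 8 L _) refl
    sync-false q 8 _ _ = sync-blocked q 8 0 refl (<ᵇ⇒< 0 4 _) (<ᵇ⇒< 8 L _) refl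
    sync-false q (suc (suc (suc (suc (suc (suc (suc (suc (suc t))))))))) _ p<L with t ≟ toℕ (code q)
    ... | no  t≢c  = sync-blocked q (9 + t) 0 (+-identityʳ (9 + t)) z<s p<L (unmarked-region q t t≢c)
    ... | yes refl = sync-blocked q (9 + t) 1 (+-comm (9 + t) 1) (<ᵇ⇒< 1 4 _) (+-monoʳ-< 10 (toℕ<n (code q)))
                                  (unmarked-region q (suc t) 1+n≢n)

    module _ {ℓ : ℕ} (L+3≤ℓ : L + 3 ≤ ℓ) where

      windowAt : ℕ → ℕ → Fin b
      windowAt n = at (window v ℓ n)

      sync-window : ∀ n j → j < L → syncAt (windowAt n) j ≡ syncAt v (n + suc j)
      sync-window n j j<L = fourOnes-cong λ k k<4 →
        trans (at-window v ℓ n (j + k) (≤-trans (+-mono-<-≤ j<L (s≤s⁻¹ k<4)) L+3≤ℓ))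
              (cong v (sym (+-assoc n (suc j) k)))

      phase-window : ∀ q {r} → r < L → phase (windowAt (q * L + r)) ≡ r
      phase-window q {r} r<L = trans (cong (λ i → L ∸ suc i) first-sync) (m∸[m∸n]≡n r≤9+K)
        where
        r≤9+K : r ≤ 9 + K
        r≤9+K = s≤s⁻¹ r<L
        i = L ∸ suc r
        i<L : i < L
        i<L = s≤s (m∸n≤m (9 + K) r)
        next-block : q * L + r + suc i ≡ suc q * L
        next-block = begin
          q * L + r + suc i    ≡⟨ +-assoc (q * L) r (suc i) ⟩
          q * L + (r + suc i)  ≡⟨ cong (_+_ (q * L)) (trans (+-suc r i) (cong suc (m+[n∸m]≡n r≤9+K))) ⟩
          q * L + L            ≡⟨ +-comm (q * L) L ⟩
          suc q * L            ∎
          where open ≡-Reasoning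
        before-next : ∀ j → j < i → syncAt (windowAt (q * L + r)) j ≡ false
        before-next j j<i = begin
          syncAt (windowAt (q * L + r)) j  ≡⟨ sync-window (q * L + r) j (<-trans j<i i<L) ⟩
          syncAt v (q * L + r + suc j)     ≡⟨ cong (syncAt v) (+-assoc (q * L) r (suc j)) ⟩
          syncAt v (q * L + (r + suc j))   ≡⟨ sync-false q (r + suc j) (<-≤-trans z<s (m≤n+m (suc j) r))
                                                (s≤s (≤-trans (+-monoʳ-≤ r j<i) (≤-reflexive (m+[n∸m]≡n r≤9+K)))) ⟩
          false                            ∎
          where open ≡-Reasoning
        first-sync : firstTrue (syncAt (windowAt (q * L + r))) L ≡ i
        first-sync = firstTrue-≡ _ i<L
          (trans (sync-window (q * L + r) i i<L) (trans (cong (syncAt v) next-block) (sync-start (suc q))))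
          before-next

      code-window : ∀ q {r} → r ≤ 8 → readCode (λ t → windowAt (q * L + r) (8 ∸ r + t)) ≡ code q
      code-window q {r} r≤8 = readCode-≡ _ (code q) λ t t<K → begin
        isOne (windowAt (q * L + r) (8 ∸ r + t))  ≡⟨ cong isOne (at-window v ℓ _ _ (within t<K)) ⟩
        isOne (v (q * L + r + suc (8 ∸ r + t)))   ≡⟨ cong (isOne ∘ v) (regroup t) ⟩
        isOne (v (q * L + (9 + t)))               ≡⟨ cong isOne (v-block q (+-monoʳ-< 9 (m<n⇒m<1+n t<K))) ⟩
        isOne (cell q (9 + t))                    ≡⟨ isOne-if (does (t ≟ toℕ (code q))) ⟩
        does (t ≟ toℕ (code q))                   ∎
        where
        open ≡-Reasoning
        within : ∀ {t} → t < K → 8 ∸ r + t < ℓ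
        within t<K = ≤-trans (+-mono-≤-< (m∸n≤m 8 r) t<K)
                             (≤-trans (m≤n+m (8 + K) 2) (≤-trans (m≤m+n L 3) L+3≤ℓ))
        regroup : ∀ t → q * L + r + suc (8 ∸ r + t) ≡ q * L + (9 + t)
        regroup t = trans (+-assoc (q * L) r (suc (8 ∸ r + t))) (cong (_+_ (q * L)) (trans (+-suc r (8 ∸ r + t))
          (cong suc (trans (sym (+-assoc r (8 ∸ r) t)) (cong (_+ t) (m+[n∸m]≡n r≤8))))))

      predictor-window : ∀ q {r} → r < L → isMarker q r ≡ false → predictor (window v ℓ (q * L + r)) ≡ cell q r
      predictor-window q {r} r<L unmarked = begin
        layout (decodedData s) (phase s)  ≡⟨ cong (layout (decodedData s)) (phase-window q r<L) ⟩
        layout (decodedData s) r          ≡⟨ layout-cong {decodedData s} {blockData} r decoded ⟩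
        layout blockData r                ≡⟨ cong (λ m → if m then one else layout blockData r) unmarked ⟨
        cell q r                          ∎
        where
        open ≡-Reasoning
        s = windowAt (q * L + r)
        blockData = λ r → u (q * L + r)
        decoded : isData r ≡ true → decodedData s r ≡ u (q * L + r)
        decoded dr = trans (cong (λ c → digit c r) (code-window q (isData⇒≤8 r dr))) (digit-code q r dr)

      errorAt : ℕ → Bool
      errorAt n = mismatch (v n) (predictor (window v ℓ n))

      error⇒marker : ∀ q r → r < L → errorAt (q * L + r) ≡ true → r ≡ 9 + toℕ (code q)
      error⇒marker q r r<L err = decidable-stable (r ≟ 9 + toℕ (code q)) λ r≢marker →
        contradiction (trans (sym err) (mismatch-≡ (trans (v-block q r<L)
          (sym (predictor-window q r<L (dec-false (r ≟ 9 + toℕ (code q)) r≢marker)))))) λ ()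

      errors-bound : ∀ N → errors {ℓ = ℓ} v predictor N * L ≤ 1 * N + 1 * L
      errors-bound = count-≤-blocks errorAt L {c = 1} λ q → count-≤1 (9 + toℕ (code q)) L (error⇒marker q)

    v-upperNoise : UpperNoiseLt b v (critical b (ratio 3 L))
    v-upperNoise = upperNoiseLt-fromErrorBound v 1 (9 + K) (L + 3) critical-gap λ ℓ L+3≤ℓ →
      predictor , errors-bound L+3≤ℓ

theorem2p1 : (b : ℕ) → 2 ≤ b →
    Σ (ℕ → Bool) λ A → Σ ℕ λ p → Periodic A p × Σ ℚ λ d → HasDensity A d ×
      ((u : ℕ → Fin b) → (∀ n → A n ≡ false → toℕ (u n) ≡ 0) →
        LowerNoiseEq b u (critical b d) →
        Σ (ℕ → Fin b) λ v → (∀ n → A n ≡ true → v n ≡ u n) ×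
          UpperNoiseLt b v (critical b d))
theorem2p1 0             ()
theorem2p1 1             (s≤s ())
theorem2p1 (suc (suc b′)) _ = A , L , A-periodic , ratio 3 L , A-density ,
  λ u _ _ → let open Encoding u in v , v-agrees , v-upperNoise
  where open Construction b′
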